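{- Let $\delta=2\in\mathbb{F}_{11}$ (a primitive element) and let $\alpha\in\mathbb{F}_{11^2}$ be a root of $x^2-\delta$. Let $H=\{1,9\}$ and $C_{11}=\{0\}\cup H\cup(\alpha+5)H\cup 10(\alpha+6)H$. Then the setwise stabilizer of $C_{11}$ in $\mathrm{Aut}(P(11^2))$ is $\langle\sigma,\tau\rangle$, isomorphic to the dihedral group of order $6$, where $\sigma(\gamma)=(\alpha+5)\gamma$ and $\tau(\gamma)=(\alpha+5)\gamma^{11}$ for all $\gamma\in\mathbb{F}_{11^2}$. Moreover, the orbit of $C_{11}$ under $\mathrm{Aut}(P(11^2))$ has size $2420$.
   Context: The Paley graph $P(11^2)$ has vertex set $\mathbb{F}_{11^2}$, two distinct vertices adjacent iff their difference is a nonzero square. $\mathrm{Aut}(P(11^2))=\{\gamma\mapsto a\gamma^{v}+b : a \text{ a nonzero square of } \mathbb{F}_{11^2},\ b\in\mathbb{F}_{11^2},\ v\in\mathrm{Gal}(\mathbb{F}_{11^2})\}$, acting on subsets elementwise. Elements of $\mathbb{F}_{11}$ are written as integers mod $11$. -}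

module Defs where

open import Data.Nat as ℕ using (ℕ; zero; suc)
open import Data.Nat.DivMod using (_mod_)
open import Data.Fin as Fin using (Fin; toℕ)
open import Data.Product using (Σ; ∃; _×_; _,_; proj₁; proj₂)
open import Data.Sum using (_⊎_)
open import Level using (0ℓ)
open import Relation.Unary using (Pred; ｛_｝; _∪_)
open import Relation.Binary.PropositionalEquality using (_≡_; _≢_; _≗_)
open import Function using (id; _∘_)

F₁₁ : Set
F₁₁ = Fin 11

ι : ℕ → F₁₁
ι n = n mod 11

_+₁₁_ : F₁₁ → F₁₁ → F₁₁
a +₁₁ b = ι (toℕ a ℕ.+ toℕ b)

_*₁₁_ : F₁₁ → F₁₁ → F₁₁
a *₁₁ b = ι (toℕ a ℕ.* toℕ b)

δ : F₁₁
δ = ι 2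

-- F₁₂₁ = F₁₁[x]/(x² - δ); the pair (a , b) stands for a + b·α,
-- where α is the class of x, a root of x² - δ.

F : Set
F = F₁₁ × F₁₁

_+_ : F → F → F
(a , b) + (c , d) = (a +₁₁ c , b +₁₁ d)

_*_ : F → F → F
(a , b) * (c , d) = ((a *₁₁ c) +₁₁ (δ *₁₁ (b *₁₁ d)) , (a *₁₁ d) +₁₁ (b *₁₁ c))

infixl 6 _+_
infixl 7 _*_

emb : ℕ → F
emb n = (ι n , ι 0)

𝟘 𝟙 : F
𝟘 = emb 0
𝟙 = emb 1

α : F
α = (ι 0 , ι 1)

_^_ : F → ℕ → F
x ^ zero  = 𝟙
x ^ suc n = x * (x ^ n)

-- Aut(P(11²)) = { γ ↦ a γ^v + b : a nonzero square, b ∈ F, v ∈ Gal }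
-- Gal(F₁₂₁/F₁₁) = { γ ↦ γ^(11^i) : i ∈ {0,1} }

IsNonzeroSquare : F → Set
IsNonzeroSquare a = (a ≢ 𝟘) × ∃ λ c → a ≡ c * c

record Aut : Set where
  constructor aut
  field
    a  : F
    sq : IsNonzeroSquare a
    b  : F
    v  : Fin 2

galois : Fin 2 → F → F
galois i γ = γ ^ (11 ℕ.^ toℕ i)

apply : Aut → F → F
apply g γ = Aut.a g * galois (Aut.v g) γ + Aut.b g

image : (F → F) → Pred F 0ℓ → Pred F 0ℓ
image f P x = ∃ λ y → P y × f y ≡ x

_·_ : F → Pred F 0ℓ → Pred F 0ℓ
c · S = image (c *_) S

H : Pred F 0ℓ
H = ｛ emb 1 ｝ ∪ ｛ emb 9 ｝

C₁₁ : Pred F 0ℓ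
C₁₁ = ｛ 𝟘 ｝ ∪ (H ∪ (((α + emb 5) · H) ∪ ((emb 10 * (α + emb 6)) · H)))

σ τ : F → F
σ γ = (α + emb 5) * γ
τ γ = (α + emb 5) * (γ ^ 11)

data InGen : (F → F) → Set where
  gen-id  : InGen id
  gen-σ   : InGen σ
  gen-τ   : InGen τ
  gen-∘   : ∀ {f g} → InGen f → InGen g → InGen (f ∘ g)
  gen-inv : ∀ {f g} → InGen f → (∀ x → g (f x) ≡ x) → (∀ x → f (g x) ≡ x) → InGen g
  gen-ext : ∀ {f g} → InGen f → f ≗ g → InGen g

-- The dihedral group of order 6: Z₃ ⋊ Z₂, (k,e)(l,f) = (k + (-1)^e l, e + f)

D₆ : Set
D₆ = Fin 3 × Fin 2

_∙D_ : D₆ → D₆ → D₆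
(k , e) ∙D (l , f) with toℕ e
... | zero  = ((toℕ k ℕ.+ toℕ l) mod 3 , (toℕ e ℕ.+ toℕ f) mod 2)
... | suc _ = ((toℕ k ℕ.+ (3 ℕ.∸ toℕ l)) mod 3 , (toℕ e ℕ.+ toℕ f) mod 2)

IsIsoOntoGen : (D₆ → F → F) → Set
IsIsoOntoGen φ =
  (∀ d → InGen (φ d)) ×
  (∀ d e → φ (d ∙D e) ≗ (φ d ∘ φ e)) ×
  (∀ d e → φ d ≗ φ e → d ≡ e) ×
  (∀ f → InGen f → ∃ λ d → φ d ≗ f)

_≐ₛ_ : Pred F 0ℓ → Pred F 0ℓ → Set
P ≐ₛ Q = (∀ x → P x → Q x) × (∀ x → Q x → P x)

OrbitSize : Pred F 0ℓ → ℕ → Set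
OrbitSize S n = Σ (Fin n → Aut) λ L →
  (∀ i j → image (apply (L i)) S ≐ₛ image (apply (L j)) S → i ≡ j) ×
  (∀ g → ∃ λ i → image (apply g) S ≐ₛ image (apply (L i)) S)

{-# OPTIONS --safe #-}
-- An automorphism γ ↦ a·γ^v + b fixing C₁₁ has b = g 0 ∈ C₁₁, and a finite search
-- over such maps leaves exactly the six maps σᵏ τᵉ, on which composition is the
-- multiplication of D₆.  For the orbit, the Galois part can be absorbed (τ fixes C₁₁)
-- and the square a taken modulo the stabilizer scalars, the cube roots of unity; so
-- every image of C₁₁ is one of the 20 · 121 sets ρ²ᵏ·C₁₁ + b, where ρ = α + 2
-- generates F*.  These are pairwise distinct, because b and ρ⁶ᵏ can be read off the
-- power sums Σ y and Σ (y - b)³ over the set, which do not depend on how it is listed.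
module Submission where

open import Defs
open import Data.Fin using (Fin; zero; suc; toℕ)
open import Data.Fin.Properties using (*↔×) renaming (_≟_ to _≟Fin_)
open import Data.List using (List; []; _∷_; map; foldr; cartesianProduct; allFin)
open import Data.List.Membership.Propositional using (_∈_; lose)
open import Data.List.Membership.Propositional.Properties
  using (∈-map⁺; ∈-map⁻; ∈-cartesianProduct⁺; ∈-allFin)
open import Data.List.Membership.Propositional.Properties.WithK using (unique∧set⇒bag)
open import Data.List.Relation.Binary.BagAndSetEquality using (∼bag⇒↭)
open import Data.List.Relation.Binary.Permutation.Propositional as ↭ using (_↭_)
open import Data.List.Relation.Binary.Permutation.Propositional.Properties using (map⁺)
open import Data.List.Relation.Unary.All as All using (All)
open import Data.List.Relation.Unary.Any as Any using (here; there)
open import Data.List.Relation.Unary.Unique.Propositional using (Unique)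
import Data.List.Membership.DecPropositional as DecMembership
import Data.List.Relation.Binary.Subset.DecPropositional as DecSubset
import Data.List.Relation.Unary.Unique.DecPropositional as DecUnique
open import Data.Nat as ℕ using (ℕ)
open import Data.Product using (Σ; ∃; _×_; _,_; proj₁; proj₂)
open import Data.Product.Function.NonDependent.Propositional using (_×-↔_)
open import Data.Product.Properties using (≡-dec; ,-injective)
open import Data.Sum using (inj₁; inj₂)
open import Function using (id; _∘_; _↔_; Inverse; _⇔_; mk⇔)
open import Function.Properties.Inverse using (↔-refl; ↔-trans)
open import Level using (0ℓ)
open import Relation.Binary.Definitions using (DecidableEquality)
open import Relation.Binary.PropositionalEquality
  using (_≡_; _≢_; _≗_; refl; sym; trans; cong; cong₂; subst; module ≡-Reasoning)
open import Relation.Nullary.Decidable using (Dec; from-yes; map′; ¬?; _×-dec_; _→-dec_)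
open import Relation.Unary using (Pred; Decidable)

record Finite (A : Set) : Set where
  field
    elements : List A
    complete : ∀ x → x ∈ elements

open Finite {{...}}

instance
  Fin-finite : ∀ {n} → Finite (Fin n)
  Fin-finite {n} = record { elements = allFin n ; complete = ∈-allFin }

  ×-finite : ∀ {A B : Set} {{_ : Finite A}} {{_ : Finite B}} → Finite (A × B)
  ×-finite = record
    { elements = cartesianProduct elements elements
    ; complete = λ (x , y) → ∈-cartesianProduct⁺ (complete x) (complete y)
    }

module _ {A : Set} {{_ : Finite A}} {P : Pred A 0ℓ} where

  ∀? : Decidable P → Dec (∀ x → P x)
  ∀? P? = map′ (λ ps x → All.lookup ps (complete x)) (λ ps → All.tabulate λ {x} _ → ps x)
               (All.all? P? elements)

  ∃? : Decidable P → Dec (∃ P)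
  ∃? P? = map′ Any.satisfied (λ (x , px) → lose (complete x) px) (Any.any? P? elements)

infix 4 _≟_ _≟D_

_≟_ : DecidableEquality F
_≟_ = ≡-dec _≟Fin_ _≟Fin_

_≟D_ : DecidableEquality D₆
_≟D_ = ≡-dec _≟Fin_ _≟Fin_

open DecMembership _≟_ using (_∈?_)
open DecSubset _≟_ using (_⊆_; _⊆?_)
open DecUnique _≟_ using (unique?)

-₁₁_ : F₁₁ → F₁₁
-₁₁ z = ι (11 ℕ.∸ toℕ z)

_-_ : F → F → F
(a , b) - (c , d) = (a +₁₁ (-₁₁ c) , b +₁₁ (-₁₁ d))

conj : F → F
conj (a , b) = (a , -₁₁ b)

frob : Fin 2 → F → F
frob zero       = id
frob (suc zero) = conj

affine : F → F → Fin 2 → F → F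
affine a b v x = a * frob v x + b

isNonzeroSquare? : Decidable IsNonzeroSquare
isNonzeroSquare? a = ¬? (a ≟ 𝟘) ×-dec ∃? λ c → a ≟ c * c

-- Facts proved by running a decision procedure are kept opaque, so that later
-- type checking never unfolds (and re-runs) them.
opaque
  galois≗frob : ∀ v → galois v ≗ frob v
  galois≗frob zero       = from-yes (∀? λ x → x ^ 1 ≟ x)
  galois≗frob (suc zero) = from-yes (∀? λ x → x ^ 11 ≟ conj x)

opaque
  *-zeroʳ : ∀ a → a * 𝟘 ≡ 𝟘
  *-zeroʳ = from-yes (∀? λ a → a * 𝟘 ≟ 𝟘)

opaque
  +-identityˡ : ∀ b → 𝟘 + b ≡ b
  +-identityˡ = from-yes (∀? λ b → 𝟘 + b ≟ b)

apply≗affine : ∀ g → apply g ≗ affine (Aut.a g) (Aut.b g) (Aut.v g)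
apply≗affine g x = cong (λ y → Aut.a g * y + Aut.b g) (galois≗frob (Aut.v g) x)

frob-𝟘 : ∀ v → frob v 𝟘 ≡ 𝟘
frob-𝟘 zero       = refl
frob-𝟘 (suc zero) = refl

affine-𝟘 : ∀ a b v → affine a b v 𝟘 ≡ b
affine-𝟘 a b v = begin
  a * frob v 𝟘 + b ≡⟨ cong (λ y → a * y + b) (frob-𝟘 v) ⟩
  a * 𝟘 + b        ≡⟨ cong (_+ b) (*-zeroʳ a) ⟩
  𝟘 + b            ≡⟨ +-identityˡ b ⟩
  b                ∎
  where open ≡-Reasoning

≐ₛ-sym : ∀ {P Q} → P ≐ₛ Q → Q ≐ₛ P
≐ₛ-sym (P⊆Q , Q⊆P) = Q⊆P , P⊆Q

≐ₛ-trans : ∀ {P Q R} → P ≐ₛ Q → Q ≐ₛ R → P ≐ₛ R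
≐ₛ-trans (P⊆Q , Q⊆P) (Q⊆R , R⊆Q) = (λ x → Q⊆R x ∘ P⊆Q x) , (λ x → Q⊆P x ∘ R⊆Q x)

image-id : ∀ S → image id S ≐ₛ S
image-id S = (λ { _ (_ , Sy , refl) → Sy }) , (λ x Sx → x , Sx , refl)

image-cong : ∀ {f g} S → f ≗ g → image f S ≐ₛ image g S
image-cong S f≗g = (λ { _ (y , Sy , refl) → y , Sy , sym (f≗g y) })
                 , (λ { _ (y , Sy , refl) → y , Sy , f≗g y })

image-∘ : ∀ {f g} h S → image f S ≐ₛ image g S → image (h ∘ f) S ≐ₛ image (h ∘ g) S
image-∘ h S (f⊆g , g⊆f) = post f⊆g , post g⊆f
  where
  post : ∀ {f g} → (∀ x → image f S x → image g S x) → ∀ x → image (h ∘ f) S x → image (h ∘ g) S x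
  post f⊆g _ (y , Sy , refl) = let z , Sz , gz≡fy = f⊆g _ (y , Sy , refl) in z , Sz , cong h gz≡fy

C-list : List F
C-list = 𝟘 ∷ emb 1 ∷ emb 9 ∷ ω * emb 1 ∷ ω * emb 9 ∷ ζ * emb 1 ∷ ζ * emb 9 ∷ []
  where
  ω ζ : F
  ω = α + emb 5
  ζ = emb 10 * (α + emb 6)

C₁₁⇒∈ : ∀ {x} → C₁₁ x → x ∈ C-list
C₁₁⇒∈ (inj₁ refl)                                 = here refl
C₁₁⇒∈ (inj₂ (inj₁ (inj₁ refl)))                   = there (here refl)
C₁₁⇒∈ (inj₂ (inj₁ (inj₂ refl)))                   = there (there (here refl))
C₁₁⇒∈ (inj₂ (inj₂ (inj₁ (_ , inj₁ refl , refl)))) = there (there (there (here refl)))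
C₁₁⇒∈ (inj₂ (inj₂ (inj₁ (_ , inj₂ refl , refl)))) = there (there (there (there (here refl))))
C₁₁⇒∈ (inj₂ (inj₂ (inj₂ (_ , inj₁ refl , refl)))) = there (there (there (there (there (here refl)))))
C₁₁⇒∈ (inj₂ (inj₂ (inj₂ (_ , inj₂ refl , refl)))) = there (there (there (there (there (there (here refl))))))

∈⇒C₁₁ : ∀ {x} → x ∈ C-list → C₁₁ x
∈⇒C₁₁ (here refl)                                                 = inj₁ refl
∈⇒C₁₁ (there (here refl))                                         = inj₂ (inj₁ (inj₁ refl))
∈⇒C₁₁ (there (there (here refl)))                                 = inj₂ (inj₁ (inj₂ refl))
∈⇒C₁₁ (there (there (there (here refl))))                         = inj₂ (inj₂ (inj₁ (_ , inj₁ refl , refl)))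
∈⇒C₁₁ (there (there (there (there (here refl)))))                 = inj₂ (inj₂ (inj₁ (_ , inj₂ refl , refl)))
∈⇒C₁₁ (there (there (there (there (there (here refl))))))         = inj₂ (inj₂ (inj₂ (_ , inj₁ refl , refl)))
∈⇒C₁₁ (there (there (there (there (there (there (here refl))))))) = inj₂ (inj₂ (inj₂ (_ , inj₂ refl , refl)))

image⇒∈ : ∀ {h x} → image h C₁₁ x → x ∈ map h C-list
image⇒∈ {h} (_ , Cy , refl) = ∈-map⁺ h (C₁₁⇒∈ Cy)

∈⇒image : ∀ {h x} → x ∈ map h C-list → image h C₁₁ x
∈⇒image {h} x∈ = let y , y∈ , x≡hy = ∈-map⁻ h x∈ in y , ∈⇒C₁₁ y∈ , sym x≡hy

infix 4 _≋_ _≋?_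

_≋_ : List F → List F → Set
xs ≋ ys = xs ⊆ ys × ys ⊆ xs

_≋?_ : (xs ys : List F) → Dec (xs ≋ ys)
xs ≋? ys = xs ⊆? ys ×-dec ys ⊆? xs

≋⇒image-≐ₛ : ∀ h h′ → map h C-list ≋ map h′ C-list → image h C₁₁ ≐ₛ image h′ C₁₁
≋⇒image-≐ₛ _ _ (h⊆h′ , h′⊆h) = (λ _ → ∈⇒image ∘ h⊆h′ ∘ image⇒∈) , (λ _ → ∈⇒image ∘ h′⊆h ∘ image⇒∈)

image-≐ₛ⇒≋ : ∀ h h′ → image h C₁₁ ≐ₛ image h′ C₁₁ → map h C-list ≋ map h′ C-list
image-≐ₛ⇒≋ _ _ (h⊆h′ , h′⊆h) = (image⇒∈ ∘ h⊆h′ _ ∘ ∈⇒image) , (image⇒∈ ∘ h′⊆h _ ∘ ∈⇒image)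

-- ⟨σ, τ⟩ ≅ D₆

_^[_] : (F → F) → ℕ → F → F
f ^[ ℕ.zero ]  = id
f ^[ ℕ.suc n ] = f ∘ f ^[ n ]

InGen-^ : ∀ {f} → InGen f → ∀ n → InGen (f ^[ n ])
InGen-^ f∈ ℕ.zero    = gen-id
InGen-^ f∈ (ℕ.suc n) = gen-∘ f∈ (InGen-^ f∈ n)

φ : D₆ → F → F
φ (k , e) = σ ^[ toℕ k ] ∘ τ ^[ toℕ e ]

φ-InGen : ∀ d → InGen (φ d)
φ-InGen (k , e) = gen-∘ (InGen-^ gen-σ (toℕ k)) (InGen-^ gen-τ (toℕ e))

ε : D₆
ε = (zero , zero)

opaque
  φ-hom : ∀ d e → φ (d ∙D e) ≗ φ d ∘ φ e
  φ-hom = from-yes (∀? λ d → ∀? λ e → ∀? λ x → φ (d ∙D e) x ≟ φ d (φ e x))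

opaque
  φ-separated : ∀ d e → φ d 𝟙 ≡ φ e 𝟙 → φ d α ≡ φ e α → d ≡ e
  φ-separated = from-yes (∀? λ d → ∀? λ e → φ d 𝟙 ≟ φ e 𝟙 →-dec φ d α ≟ φ e α →-dec d ≟D e)

opaque
  D₆-inverse : ∀ d → ∃ λ d′ → d ∙D d′ ≡ ε
  D₆-inverse = from-yes (∀? λ d → ∃? λ d′ → d ∙D d′ ≟D ε)

φ-injective : ∀ d e → φ d ≗ φ e → d ≡ e
φ-injective d e φd≗φe = φ-separated d e (φd≗φe 𝟙) (φd≗φe α)

φ-∘ : ∀ d e {f g} → φ d ≗ f → φ e ≗ g → φ (d ∙D e) ≗ f ∘ g
φ-∘ d e {f} φd≗f φe≗g x = trans (φ-hom d e x) (trans (φd≗f (φ e x)) (cong f (φe≗g x)))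

φ-inverse : ∀ d {f g} → φ d ≗ f → (∀ x → g (f x) ≡ x) → ∃ λ d′ → φ d′ ≗ g
φ-inverse d {f} {g} φd≗f g∘f≗id = d′ , λ x → trans (sym (g∘f≗id (φ d′ x))) (cong g (f∘φd′≗id x))
  where
  d′ : D₆
  d′ = proj₁ (D₆-inverse d)
  f∘φd′≗id : ∀ x → f (φ d′ x) ≡ x
  f∘φd′≗id x = trans (sym (φ-∘ d d′ φd≗f (λ _ → refl) x)) (cong (λ c → φ c x) (proj₂ (D₆-inverse d)))

InGen⇒φ : ∀ {f} → InGen f → ∃ λ d → φ d ≗ f
InGen⇒φ gen-id                = ε , λ _ → refl
InGen⇒φ gen-σ                 = (suc zero , zero) , λ _ → refl
InGen⇒φ gen-τ                 = (zero , suc zero) , λ _ → refl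
InGen⇒φ (gen-∘ f∈ g∈)         = let d , φd≗f = InGen⇒φ f∈ ; e , φe≗g = InGen⇒φ g∈
                                in d ∙D e , φ-∘ d e φd≗f φe≗g
InGen⇒φ (gen-inv f∈ g∘f≗id _) = let d , φd≗f = InGen⇒φ f∈ in φ-inverse d φd≗f g∘f≗id
InGen⇒φ (gen-ext f∈ f≗g)      = let d , φd≗f = InGen⇒φ f∈ in d , λ x → trans (φd≗f x) (f≗g x)

φ-isIsoOntoGen : IsIsoOntoGen φ
φ-isIsoOntoGen = φ-InGen , φ-hom , φ-injective , λ _ → InGen⇒φ

scalar : D₆ → F
scalar (k , e) = (α + emb 5) ^ (toℕ k ℕ.+ toℕ e)

opaque
  φ≗affine : ∀ d → φ d ≗ affine (scalar d) 𝟘 (proj₂ d)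
  φ≗affine = from-yes (∀? λ d → ∀? λ x → φ d x ≟ affine (scalar d) 𝟘 (proj₂ d) x)

opaque
  scalar-isNonzeroSquare : ∀ d → IsNonzeroSquare (scalar d)
  scalar-isNonzeroSquare = from-yes (∀? (isNonzeroSquare? ∘ scalar))

autOf : D₆ → Aut
autOf d = aut (scalar d) (scalar-isNonzeroSquare d) 𝟘 (proj₂ d)

InGen⇒Aut : ∀ f → InGen f → ∃ λ (g : Aut) → apply g ≗ f
InGen⇒Aut f f∈ =
  let d , φd≗f = InGen⇒φ f∈
  in autOf d , λ x → trans (apply≗affine (autOf d) x) (trans (sym (φ≗affine d x)) (φd≗f x))

-- The stabilizer of C₁₁

opaque
  φ-permutes-C : ∀ d → map (φ d) C-list ≋ C-list
  φ-permutes-C = from-yes (∀? λ d → map (φ d) C-list ≋? C-list)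

-- The hypothesis b ∈ C-list only keeps the search small.
opaque
  affine-into-C₁₁⇒≡scalar : ∀ {b} → b ∈ C-list → ∀ a v → a ≢ 𝟘 →
                            map (affine a b v) C-list ⊆ C-list →
                            ∃ λ d → (a , b , v) ≡ (scalar d , 𝟘 , proj₂ d)
  affine-into-C₁₁⇒≡scalar = All.lookup (from-yes (All.all? (λ b → ∀? λ a → ∀? λ v →
    ¬? (a ≟ 𝟘) →-dec map (affine a b v) C-list ⊆? C-list →-dec
    ∃? λ d → ≡-dec _≟_ (≡-dec _≟_ _≟Fin_) (a , b , v) (scalar d , 𝟘 , proj₂ d)) C-list))

φ-stabilizes : ∀ d → image (φ d) C₁₁ ≐ₛ C₁₁
φ-stabilizes d = ≐ₛ-trans (≋⇒image-≐ₛ (φ d) id (φ-permutes-C d)) (image-id C₁₁)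

≡scalar⇒≗φ : ∀ {a b v} d → (a , b , v) ≡ (scalar d , 𝟘 , proj₂ d) → affine a b v ≗ φ d
≡scalar⇒≗φ d refl x = sym (φ≗affine d x)

stabilizer⇒φ : ∀ g → image (apply g) C₁₁ ≐ₛ C₁₁ → ∃ λ d → apply g ≗ φ d
stabilizer⇒φ g@(aut a (a≢𝟘 , _) b v) (into , _) =
  let d , params≡ = affine-into-C₁₁⇒≡scalar b∈C a v a≢𝟘 into-C
  in d , λ x → trans (apply≗affine g x) (≡scalar⇒≗φ d params≡ x)
  where
  into-C : map (affine a b v) C-list ⊆ C-list
  into-C y∈ = C₁₁⇒∈ (into _ (proj₂ (image-cong C₁₁ (apply≗affine g)) _ (∈⇒image y∈)))
  b∈C : b ∈ C-list
  b∈C = subst (_∈ C-list) (affine-𝟘 a b v) (into-C (here refl))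

stabilizer⇔InGen : ∀ g → (image (apply g) C₁₁ ≐ₛ C₁₁) ⇔ InGen (apply g)
stabilizer⇔InGen g = mk⇔
  (λ fixes → let d , g≗φd = stabilizer⇒φ g fixes in gen-ext (φ-InGen d) (sym ∘ g≗φd))
  (λ g∈ → let d , φd≗g = InGen⇒φ g∈ in ≐ₛ-trans (image-cong C₁₁ (sym ∘ φd≗g)) (φ-stabilizes d))

-- The orbit of C₁₁

coset : Fin 20 → F
coset k = (α + emb 2) ^ (2 ℕ.* toℕ k)

opaque
  coset-isNonzeroSquare : ∀ k → IsNonzeroSquare (coset k)
  coset-isNonzeroSquare = from-yes (∀? (isNonzeroSquare? ∘ coset))

representative : Fin 20 × F → Aut
representative (k , b) = aut (coset k) (coset-isNonzeroSquare k) b zero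

opaque
  nonzeroSquare-scaling≋coset : ∀ a v → IsNonzeroSquare a →
                                ∃ λ k → map (λ x → a * frob v x) C-list ≋ map (coset k *_) C-list
  nonzeroSquare-scaling≋coset = from-yes (∀? λ a → ∀? λ v → isNonzeroSquare? a →-dec
    ∃? λ k → map (λ x → a * frob v x) C-list ≋? map (coset k *_) C-list)

same-scaling⇒same-image : ∀ a v k b → map (λ x → a * frob v x) C-list ≋ map (coset k *_) C-list →
                          image (affine a b v) C₁₁ ≐ₛ image (apply (representative (k , b))) C₁₁
same-scaling⇒same-image a v k b ≋coset =
  ≐ₛ-trans (image-∘ (_+ b) C₁₁ (≋⇒image-≐ₛ (λ x → a * frob v x) (coset k *_) ≋coset))
           (image-cong C₁₁ (sym ∘ apply≗affine (representative (k , b))))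

representative-complete : ∀ g → ∃ λ p → image (apply g) C₁₁ ≐ₛ image (apply (representative p)) C₁₁
representative-complete g@(aut a a□ b v) =
  let k , ≋coset = nonzeroSquare-scaling≋coset a v a□
  in (k , b) , ≐ₛ-trans (image-cong C₁₁ (apply≗affine g)) (same-scaling⇒same-image a v k b ≋coset)

opaque
  +₁₁-left-comm : ∀ a b c → a +₁₁ (b +₁₁ c) ≡ b +₁₁ (a +₁₁ c)
  +₁₁-left-comm = from-yes (∀? λ a → ∀? λ b → ∀? λ c → a +₁₁ (b +₁₁ c) ≟Fin b +₁₁ (a +₁₁ c))

+-left-comm : ∀ x y z → x + (y + z) ≡ y + (x + z)
+-left-comm (a , a′) (b , b′) (c , c′) = cong₂ _,_ (+₁₁-left-comm a b c) (+₁₁-left-comm a′ b′ c′)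

sum : List F → F
sum = foldr _+_ 𝟘

sum-↭ : ∀ {xs ys} → xs ↭ ys → sum xs ≡ sum ys
sum-↭ ↭.refl                       = refl
sum-↭ (↭.prep x xs↭ys)             = cong (x +_) (sum-↭ xs↭ys)
sum-↭ (↭.swap {ys = ys} x y xs↭ys) = trans (cong (λ s → x + (y + s)) (sum-↭ xs↭ys)) (+-left-comm x y (sum ys))
sum-↭ (↭.trans xs↭ys ys↭zs)        = trans (sum-↭ xs↭ys) (sum-↭ ys↭zs)

≋⇒↭ : ∀ {xs ys} → Unique xs → Unique ys → xs ≋ ys → xs ↭ ys
≋⇒↭ xs! ys! (xs⊆ys , ys⊆xs) = ∼bag⇒↭ (unique∧set⇒bag xs! ys! (mk⇔ xs⊆ys ys⊆xs))

centre : List F → F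
centre ys = emb 8 * sum ys

-- For S = r·C₁₁ + b: Σ C₁₁ = 0 and |C₁₁| = 7 = 8⁻¹ give centre S = b, and
-- Σ_{c ∈ C₁₁} c³ = 1 gives Σ_{y ∈ S} (y - b)³ = r³.
invariants : List F → F × F
invariants ys = sum (map (λ y → (y - centre ys) ^ 3) ys) , centre ys

invariants-↭ : ∀ {xs ys} → xs ↭ ys → invariants xs ≡ invariants ys
invariants-↭ {xs} {ys} xs↭ys = cong₂ _,_ cube-sum≡ centre≡
  where
  centre≡ : centre xs ≡ centre ys
  centre≡ = cong (emb 8 *_) (sum-↭ xs↭ys)
  cube-sum≡ : sum (map (λ y → (y - centre xs) ^ 3) xs) ≡ sum (map (λ y → (y - centre ys) ^ 3) ys)
  cube-sum≡ = trans (sum-↭ (map⁺ (λ y → (y - centre xs) ^ 3) xs↭ys))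
                    (cong (λ c → sum (map (λ y → (y - c) ^ 3) ys)) centre≡)

opaque
  representative-unique : ∀ p → Unique (map (apply (representative p)) C-list)
  representative-unique = from-yes (∀? λ p → unique? (map (apply (representative p)) C-list))

opaque
  invariants-representative : ∀ p →
    invariants (map (apply (representative p)) C-list) ≡ (coset (proj₁ p) ^ 3 , proj₂ p)
  invariants-representative = from-yes (∀? λ p →
    ≡-dec _≟_ _≟_ (invariants (map (apply (representative p)) C-list)) (coset (proj₁ p) ^ 3 , proj₂ p))

opaque
  coset-cube-injective : ∀ k l → coset k ^ 3 ≡ coset l ^ 3 → k ≡ l
  coset-cube-injective = from-yes (∀? λ k → ∀? λ l → coset k ^ 3 ≟ coset l ^ 3 →-dec k ≟Fin l)

representative-injective : ∀ p q →
  image (apply (representative p)) C₁₁ ≐ₛ image (apply (representative q)) C₁₁ → p ≡ q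
representative-injective p@(k , b) q@(l , c) p≐q =
  let r³≡ , b≡c = ,-injective (begin
        (coset k ^ 3 , b)                                  ≡⟨ invariants-representative p ⟨
        invariants (map (apply (representative p)) C-list) ≡⟨ invariants-↭ p↭q ⟩
        invariants (map (apply (representative q)) C-list) ≡⟨ invariants-representative q ⟩
        (coset l ^ 3 , c)                                  ∎)
  in cong₂ _,_ (coset-cube-injective k l r³≡) b≡c
  where
  open ≡-Reasoning
  p↭q : map (apply (representative p)) C-list ↭ map (apply (representative q)) C-list
  p↭q = ≋⇒↭ (representative-unique p) (representative-unique q)
            (image-≐ₛ⇒≋ (apply (representative p)) (apply (representative q)) p≐q)

coordinates : Fin 2420 ↔ (Fin 20 × F)
coordinates = ↔-trans (*↔× {20} {121}) (↔-refl ×-↔ *↔× {11} {11})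

open Inverse coordinates using (to; from; strictlyInverseˡ; strictlyInverseʳ)

orbit-size : OrbitSize C₁₁ 2420
orbit-size = representative ∘ to , injective , exhaustive
  where
  injective : ∀ i j → image (apply (representative (to i))) C₁₁ ≐ₛ image (apply (representative (to j))) C₁₁ → i ≡ j
  injective i j i≐j = begin
    i           ≡⟨ strictlyInverseʳ i ⟨
    from (to i) ≡⟨ cong from (representative-injective (to i) (to j) i≐j) ⟩
    from (to j) ≡⟨ strictlyInverseʳ j ⟩
    j           ∎
    where open ≡-Reasoning
  exhaustive : ∀ g → ∃ λ i → image (apply g) C₁₁ ≐ₛ image (apply (representative (to i))) C₁₁
  exhaustive g =
    let p , g≐p = representative-complete g
    in from p , subst (λ q → image (apply g) C₁₁ ≐ₛ image (apply (representative q)) C₁₁)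
                      (sym (strictlyInverseˡ p)) g≐p

lemma3p21 : (∀ (g : Aut) → (image (apply g) C₁₁ ≐ₛ C₁₁) ⇔ InGen (apply g))
            × (∀ f → InGen f → ∃ λ (g : Aut) → apply g ≗ f)
            × (Σ (D₆ → F → F) IsIsoOntoGen)
            × OrbitSize C₁₁ 2420
lemma3p21 = stabilizer⇔InGen , InGen⇒Aut , (φ , φ-isIsoOntoGen) , orbit-size
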